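{- Let $\varphi$ be a substitution on a finite alphabet $A$ that extends over a letter $a_1\in A$, let $h\colon A^*\to B^*$ be a morphism, and let $u\in B^*$ be a finite word. Then there is an algorithm (taking $\varphi$, $a_1$, $h$, $u$ as input) that checks whether $u$ occurs in $W=h(\varphi^{\infty}(a_1))$ and, if it does, whether it occurs in $W$ only finitely many times.
   Context: A substitution is a morphism $\varphi\colon A^*\to A^*$ of free monoids. It extends over $a_1$ if $\varphi(a_1)=a_1v$ with $\varphi^k(v)\neq\varepsilon$ for all $k\in\mathbb N$; then $\varphi^{\infty}(a_1)=a_1v\varphi(v)\varphi^2(v)\cdots$, and $h(\varphi^{\infty}(a_1))$ is obtained by applying $h$ letter by letter. -}

module Defs where

open import Data.Nat using (ℕ; zero; suc; _<_)
open import Data.Fin using (Fin)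
open import Data.List using (List; []; _∷_; concatMap; take; drop; length)
open import Data.Product using (Σ; ∃; _×_)
open import Relation.Binary.PropositionalEquality using (_≡_; _≢_)

morph : {A B : Set} → (A → List B) → List A → List B
morph f = concatMap f

iter : {A : Set} → (A → List A) → ℕ → List A → List A
iter φ zero    w = w
iter φ (suc k) w = morph φ (iter φ k w)

Extends : {n : ℕ} → (Fin n → List (Fin n)) → Fin n → Set
Extends φ a1 = Σ (List _) λ v → (φ a1 ≡ a1 ∷ v) × (∀ k → iter φ k v ≢ [])

OccursAtList : {B : Set} → List B → ℕ → List B → Set
OccursAtList u i w = take (length u) (drop i w) ≡ u

-- W = h(φ^∞(a1)) is the union of its increasing prefixes h(φ^k(a1)), k ∈ ℕ.
-- u occurs at position i of W iff it occurs at position i of some such prefix.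
OccursAt : {n m : ℕ} → (Fin n → List (Fin n)) → Fin n → (Fin n → List (Fin m))
         → List (Fin m) → ℕ → Set
OccursAt φ a1 h u i = ∃ λ k → OccursAtList u i (morph h (iter φ k (a1 ∷ [])))

Occurs : {n m : ℕ} → (Fin n → List (Fin n)) → Fin n → (Fin n → List (Fin m))
       → List (Fin m) → Set
Occurs φ a1 h u = ∃ λ i → OccursAt φ a1 h u i

OccursFinitelyOften : {n m : ℕ} → (Fin n → List (Fin n)) → Fin n → (Fin n → List (Fin m))
                    → List (Fin m) → Set
OccursFinitelyOften φ a1 h u = ∃ λ N → ∀ i → OccursAt φ a1 h u i → i < N

-- Run the finite automaton that remembers the last |u| letters read.  The profile of a
-- word x records, for every state, the state reached after x and whether an occurrence
-- of u is completed inside x.  Profiles compose along concatenation, so the profiles of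
-- the letter images h(φ^k(a)) determine those of h(φ^(k+1)(a)); as there are finitely
-- many families of profiles, the sequence k ↦ (profiles of h ∘ φ^k) repeats, say at
-- i < j, and is periodic from i on.  Writing X_k = h(φ^k(a1)) and Y_k = h(φ^k(v)), so
-- that X_(k+1) = X_k Y_k, u occurs in W iff it occurs in some X_k with k < j, and it
-- occurs infinitely often iff for some k ∈ [i, j) an occurrence of u ends inside Y_k:
-- such a k recurs with period j − i, each time further to the right, while otherwise
-- every occurrence of u starts inside X_i.
module Submission where

open import Defs
open import Data.Bool using (Bool; false; T; _∨_)
open import Data.Bool.Properties using (T-∨; ∨-assoc)
open import Data.Empty using (⊥-elim)
open import Data.Fin using (Fin; toℕ; inject₁; combine; funToFin; finToFun)
  renaming (zero to fzero; suc to fsuc)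
open import Data.Fin.Properties using (pigeonhole; all?; combine-injective; finToFun-funToFin; 2↔Bool)
  renaming (_≟_ to _≟ᶠ_)
open import Data.List using (List; []; _∷_; _++_; [_]; length; reverse; drop; foldl)
open import Data.List.Properties
  using (++-assoc; ++-identityʳ; ∷-injective; concatMap-++; take++drop≡id; foldl-++;
         length-++; length-++-≤ˡ; length-++-≤ʳ; reverse-++; reverse-involutive; length-reverse)
open import Data.Nat using (ℕ; zero; suc; _+_; _*_; _^_; _≤_; _<_; _≤′_; ≤′-refl; ≤′-step; z≤n; s≤s)
open import Data.Nat.Properties
  using (≤-refl; ≤-trans; <⇒≤; ≤-<-trans; <-≤-trans; <-irrefl; <⇒≱; ≮⇒≥; ≰⇒>; ≤∧≮⇒≡;
         m≤n⇒m≤1+n; n<1+n; m<m+n; +-cancelʳ-<; ≤⇒≤′; _<?_; _≤?_; anyUpTo?)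
open import Data.Product using (∃; ∃₂; _×_; _,_; proj₁; proj₂)
open import Data.Sum using (inj₁; inj₂)
open import Function using (_∘_; _⇔_; mk⇔; Inverse; Equivalence)
open import Relation.Nullary using (Dec; yes; no; ¬_)
open import Relation.Nullary.Decidable
  using (isYes; toWitness; fromWitness; map′; T?; ¬?; _×-dec_; decidable-stable)
open import Relation.Binary.PropositionalEquality
  using (_≡_; _≗_; refl; sym; trans; cong; cong₂; subst; module ≡-Reasoning)

open ≡-Reasoning

morph-∘ : {A B C : Set} (g : B → List C) (f : A → List B) (w : List A) →
          morph g (morph f w) ≡ morph (morph g ∘ f) w
morph-∘ g f [] = refl
morph-∘ g f (a ∷ w) = trans (concatMap-++ g (f a) (morph f w)) (cong (morph g (f a) ++_) (morph-∘ g f w))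

iter-suc : {A : Set} (φ : A → List A) (k : ℕ) (w : List A) → iter φ (suc k) w ≡ iter φ k (morph φ w)
iter-suc φ zero w = refl
iter-suc φ (suc k) w = cong (morph φ) (iter-suc φ k w)

module _ {A B : Set} (φ : A → List A) (h : A → List B) where

  image : ℕ → A → List B
  image zero a = h a
  image (suc k) a = morph (image k) (φ a)

  morph-iter : ∀ k w → morph h (iter φ k w) ≡ morph (image k) w
  morph-iter zero w = refl
  morph-iter (suc k) w = begin
    morph h (iter φ (suc k) w)       ≡⟨ cong (morph h) (iter-suc φ k w) ⟩
    morph h (iter φ k (morph φ w))   ≡⟨ morph-iter k (morph φ w) ⟩
    morph (image k) (morph φ w)      ≡⟨ morph-∘ (image k) φ w ⟩
    morph (image (suc k)) w          ∎

++-equidivisible : {B : Set} (a b c d : List B) → a ++ b ≡ c ++ d → length a ≤ length c →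
                   ∃ λ e → c ≡ a ++ e × b ≡ e ++ d
++-equidivisible [] b c d eq _ = c , refl , eq
++-equidivisible (x ∷ a) b (y ∷ c) d eq (s≤s a≤c) with refl , eq′ ← ∷-injective eq =
  let e , c≡ae , b≡ed = ++-equidivisible a b c d eq′ a≤c in e , cong (x ∷_) c≡ae , b≡ed

prefix-length : {B : Set} (w : List B) {x z : List B} → x ≡ w ++ z → length w ≤ length x
prefix-length w refl = length-++-≤ˡ w

nonempty-suffix : {B : Set} (x e : List B) → length x < length (x ++ e) → 0 < length e
nonempty-suffix x [] x<x = ⊥-elim (<-irrefl (cong length (sym (++-identityʳ x))) x<x)
nonempty-suffix x (_ ∷ _) _ = s≤s z≤n

occursAt-++ : {B : Set} (u y z : List B) → OccursAtList u (length y) (y ++ u ++ z)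
occursAt-++ [] y z = refl
occursAt-++ (c ∷ u) [] z = cong (c ∷_) (occursAt-++ u [] z)
occursAt-++ u (_ ∷ y) z = occursAt-++ u y z

occursAt⇒split : {B : Set} (c : B) (u : List B) (p : ℕ) (w : List B) → OccursAtList (c ∷ u) p w →
                 ∃₂ λ y z → w ≡ y ++ (c ∷ u) ++ z × length y ≡ p
occursAt⇒split c u zero w occ =
  [] , drop (length (c ∷ u)) w ,
  trans (sym (take++drop≡id (length (c ∷ u)) w)) (cong (_++ drop (length (c ∷ u)) w) occ) , refl
occursAt⇒split c u (suc p) (b ∷ w) occ =
  let y , z , w≡yuz , |y|≡p = occursAt⇒split c u p w occ in b ∷ y , z , cong (b ∷_) w≡yuz , cong suc |y|≡p

-- An occurrence of u in s ++ w whose last letter lies in w.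
EndsInside : {B : Set} → List B → List B → List B → Set
EndsInside u s w = ∃₂ λ w₁ w₂ → w ≡ w₁ ++ w₂ × 0 < length w₁ × ∃ λ y → s ++ w₁ ≡ y ++ u

endsInside⇒occursAt : {B : Set} (u s w : List B) → EndsInside u s w →
                      ∃ λ p → OccursAtList u p (s ++ w) × length s < p + length u
endsInside⇒occursAt u s w (w₁ , w₂ , refl , 0<|w₁| , y , sw₁≡yu) =
  length y , subst (OccursAtList u (length y)) (sym sw≡yuw₂) (occursAt-++ u y w₂) , s<yu
  where
  sw≡yuw₂ : s ++ w₁ ++ w₂ ≡ y ++ u ++ w₂
  sw≡yuw₂ = begin
    s ++ w₁ ++ w₂     ≡⟨ ++-assoc s w₁ w₂ ⟨
    (s ++ w₁) ++ w₂   ≡⟨ cong (_++ w₂) sw₁≡yu ⟩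
    (y ++ u) ++ w₂    ≡⟨ ++-assoc y u w₂ ⟩
    y ++ u ++ w₂      ∎
  s<yu : length s < length y + length u
  s<yu = subst (length s <_) (trans (sym (length-++ s)) (trans (cong length sw₁≡yu) (length-++ y)))
               (m<m+n (length s) 0<|w₁|)

endsInside⇒longer : {B : Set} (u s w : List B) → EndsInside u s w → length s < length (s ++ w)
endsInside⇒longer u s w (w₁ , w₂ , refl , 0<|w₁| , _) =
  <-≤-trans (subst (length s <_) (sym (length-++ s)) (m<m+n (length s) 0<|w₁|))
            (prefix-length (s ++ w₁) (sym (++-assoc s w₁ w₂)))

occurs⇔endsInside : {B : Set} (c : B) (u w : List B) →
                    (∃ λ p → OccursAtList (c ∷ u) p w) ⇔ EndsInside (c ∷ u) [] w
occurs⇔endsInside c u w = mk⇔ to from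
  where
  to : (∃ λ p → OccursAtList (c ∷ u) p w) → EndsInside (c ∷ u) [] w
  to (p , occ) =
    let y , z , w≡yuz , _ = occursAt⇒split c u p w occ
    in y ++ c ∷ u , z , trans w≡yuz (sym (++-assoc y (c ∷ u) z)) ,
       ≤-trans (s≤s z≤n) (length-++-≤ʳ (c ∷ u) {y}) , y , refl
  from : EndsInside (c ∷ u) [] w → ∃ λ p → OccursAtList (c ∷ u) p w
  from ends = let p , occ , _ = endsInside⇒occursAt (c ∷ u) [] w ends in p , occ

-- Increasing chains of prefixes

module PrefixChain {B : Set} (X Y : ℕ → List B) (X-suc : ∀ k → X (suc k) ≡ X k ++ Y k) where

  length-X-mono : ∀ {k k′} → k ≤ k′ → length (X k) ≤ length (X k′)
  length-X-mono = go ∘ ≤⇒≤′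
    where
    go : ∀ {k k′} → k ≤′ k′ → length (X k) ≤ length (X k′)
    go ≤′-refl = ≤-refl
    go (≤′-step {k′} k≤′k′) = ≤-trans (go k≤′k′) (prefix-length (X k′) (X-suc k′))

  crossing : ∀ k′ K (w z : List B) → X k′ ≡ w ++ z → length (X K) < length w →
             ∃ λ k → K ≤ k × ∃₂ λ e e′ → w ≡ X k ++ e × Y k ≡ e ++ e′ × 0 < length e
  crossing zero K w z X≡wz XK<w =
    ⊥-elim (<⇒≱ XK<w (≤-trans (prefix-length w X≡wz) (length-X-mono z≤n)))
  crossing (suc k) K w z X≡wz XK<w with length w ≤? length (X k)
  ... | yes w≤Xk =
    let e , Xk≡we , _ = ++-equidivisible w z (X k) (Y k) (trans (sym X≡wz) (X-suc k)) w≤Xk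
    in crossing k K w e Xk≡we XK<w
  ... | no w≰Xk =
    let Xk<w = ≰⇒> w≰Xk
        e , w≡Xke , Yk≡ez = ++-equidivisible (X k) (Y k) w z (trans (sym (X-suc k)) X≡wz) (<⇒≤ Xk<w)
        K≤k = ≮⇒≥ λ k<K → <⇒≱ XK<w (≤-trans (prefix-length w X≡wz) (length-X-mono k<K))
    in k , K≤k , e , z , w≡Xke , Yk≡ez ,
       nonempty-suffix (X k) e (subst (length (X k) <_) (cong length w≡Xke) Xk<w)

  occursAt⇒endsInside : (c : B) (u : List B) → ∀ K {k′ p} → OccursAtList (c ∷ u) p (X k′) →
                        length (X K) ≤ p → ∃ λ k → K ≤ k × EndsInside (c ∷ u) (X k) (Y k)
  occursAt⇒endsInside c u K {k′} {p} occ XK≤p =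
    let y , z , X≡yuz , |y|≡p = occursAt⇒split c u p (X k′) occ
        XK<yu = ≤-<-trans (subst (length (X K) ≤_) (sym |y|≡p) XK≤p)
                  (subst (length y <_) (sym (length-++ y)) (m<m+n (length y) (s≤s z≤n)))
        k , K≤k , e , e′ , yu≡Xke , Yk≡ee′ , 0<|e| =
          crossing k′ K (y ++ c ∷ u) z (trans X≡yuz (sym (++-assoc y (c ∷ u) z))) XK<yu
    in k , K≤k , e , e′ , Yk≡ee′ , 0<|e| , y , sym yu≡Xke

  module _ (u : List B) (recurs : ∀ t → ∃ λ k → t ≤ k × EndsInside u (X k) (Y k)) where

    long-endsInside : ∀ t → ∃ λ k → t ≤ length (X k) × EndsInside u (X k) (Y k)
    long-endsInside zero = let k , _ , ends = recurs 0 in k , z≤n , ends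
    long-endsInside (suc t) =
      let k , t≤Xk , ends = long-endsInside t
          k′ , k<k′ , ends′ = recurs (suc k)
          Xk<Xk+1 = subst (λ x → length (X k) < length x) (sym (X-suc k)) (endsInside⇒longer u (X k) (Y k) ends)
      in k′ , ≤-<-trans t≤Xk (<-≤-trans Xk<Xk+1 (length-X-mono k<k′)) , ends′

    occurrences-unbounded : ∀ N → ∃₂ λ k p → N ≤ p × OccursAtList u p (X k)
    occurrences-unbounded N =
      let k , N+u≤Xk , ends = long-endsInside (N + length u)
          p , occ , Xk<p+u = endsInside⇒occursAt u (X k) (Y k) ends
      in suc k , p , <⇒≤ (+-cancelʳ-< (length u) N p (≤-<-trans N+u≤Xk Xk<p+u)) ,
         subst (OccursAtList u p) (sym (X-suc k)) occ

-- Eventually periodic sequences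

module Repetition {C : Set} (e : ℕ → C) (det : ∀ {k k′} → e k ≡ e k′ → e (suc k) ≡ e (suc k′))
                  {i j : ℕ} (i<j : i < j) (eᵢ≡eⱼ : e i ≡ e j) where

  window-representative : ∀ {k} → i ≤ k → ∃ λ k′ → i ≤ k′ × k′ < j × e k ≡ e k′
  window-representative = go ∘ ≤⇒≤′
    where
    go : ∀ {k} → i ≤′ k → ∃ λ k′ → i ≤ k′ × k′ < j × e k ≡ e k′
    go ≤′-refl = i , ≤-refl , i<j , refl
    go (≤′-step i≤′k) with go i≤′k
    ... | k′ , i≤k′ , k′<j , eq with suc k′ <? j
    ...   | yes k′+1<j = suc k′ , m≤n⇒m≤1+n i≤k′ , k′+1<j , det eq
    ...   | no  k′+1≮j = i , ≤-refl , i<j , trans (det eq) (trans (cong e (≤∧≮⇒≡ k′<j k′+1≮j)) (sym eᵢ≡eⱼ))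

  representative : ∀ k → ∃ λ k′ → k′ < j × e k ≡ e k′
  representative k with k <? j
  ... | yes k<j = k , k<j , refl
  ... | no  k≮j = let k′ , _ , k′<j , eq = window-representative (≤-trans (<⇒≤ i<j) (≮⇒≥ k≮j)) in k′ , k′<j , eq

  later : ∀ {k} → i ≤ k → ∃ λ k′ → k < k′ × e k ≡ e k′
  later = go ∘ ≤⇒≤′
    where
    go : ∀ {k} → i ≤′ k → ∃ λ k′ → k < k′ × e k ≡ e k′
    go ≤′-refl = j , i<j , eᵢ≡eⱼ
    go (≤′-step i≤′k) = let k′ , k<k′ , eq = go i≤′k in suc k′ , s≤s k<k′ , det eq

  recurrent : ∀ {k} → i ≤ k → ∀ t → ∃ λ k′ → t ≤ k′ × i ≤ k′ × e k ≡ e k′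
  recurrent i≤k zero = _ , z≤n , i≤k , refl
  recurrent i≤k (suc t) =
    let k′ , t≤k′ , i≤k′ , eq = recurrent i≤k t
        k″ , k′<k″ , eq′ = later i≤k′
    in k″ , ≤-<-trans t≤k′ k′<k″ , ≤-trans i≤k′ (<⇒≤ k′<k″) , trans eq eq′

sequence-repeats : {N : ℕ} (e : ℕ → Fin N) → ∃₂ λ i j → i < j × e i ≡ e j
sequence-repeats e = let x , y , x<y , eq = pigeonhole (n<1+n _) (e ∘ toℕ) in toℕ x , toℕ y , x<y , eq

-- Automata and profiles

funToFin-cong : {a b : ℕ} {f g : Fin a → Fin b} → f ≗ g → funToFin f ≡ funToFin g
funToFin-cong {zero} _ = refl
funToFin-cong {suc a} f≗g = cong₂ combine (f≗g fzero) (funToFin-cong (f≗g ∘ fsuc))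

funToFin-injective : {a b : ℕ} {f g : Fin a → Fin b} → funToFin f ≡ funToFin g → f ≗ g
funToFin-injective {f = f} {g} eq x =
  trans (sym (finToFun-funToFin f x)) (trans (cong (λ c → finToFun c x) eq) (finToFun-funToFin g x))

module Automaton {B : Set} {s : ℕ} (δ : Fin s → B → Fin s) (accepting : Fin s → Bool) where

  run : Fin s → List B → Fin s
  run = foldl δ

  -- the state q itself, before any letter is read, does not count
  visits : Fin s → List B → Bool
  visits q [] = false
  visits q (b ∷ w) = accepting (δ q b) ∨ visits (δ q b) w

  visits-++ : ∀ q x y → visits q (x ++ y) ≡ visits q x ∨ visits (run q x) y
  visits-++ q [] y = refl
  visits-++ q (b ∷ x) y =
    trans (cong (accepting (δ q b) ∨_) (visits-++ (δ q b) x y)) (sym (∨-assoc (accepting (δ q b)) _ _))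

  visits⇔ : ∀ q w → T (visits q w) ⇔ ∃₂ λ w₁ w₂ → w ≡ w₁ ++ w₂ × 0 < length w₁ × T (accepting (run q w₁))
  visits⇔ q w = mk⇔ (to q w) from
    where
    to : ∀ q w → T (visits q w) → ∃₂ λ w₁ w₂ → w ≡ w₁ ++ w₂ × 0 < length w₁ × T (accepting (run q w₁))
    to q (b ∷ w) visit with Equivalence.to T-∨ visit
    ... | inj₁ acc = [ b ] , w , refl , s≤s z≤n , acc
    ... | inj₂ visit′ = let w₁ , w₂ , w≡w₁w₂ , _ , acc = to (δ q b) w visit′
                        in b ∷ w₁ , w₂ , cong (b ∷_) w≡w₁w₂ , s≤s z≤n , acc
    visits-prefix : ∀ q b w₁ w₂ → T (accepting (run q (b ∷ w₁))) → T (visits q (b ∷ w₁ ++ w₂))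
    visits-prefix q b [] w₂ acc = Equivalence.from T-∨ (inj₁ acc)
    visits-prefix q b (b′ ∷ w₁) w₂ acc =
      Equivalence.from (T-∨ {accepting (δ q b)}) (inj₂ (visits-prefix (δ q b) b′ w₁ w₂ acc))
    from : (∃₂ λ w₁ w₂ → w ≡ w₁ ++ w₂ × 0 < length w₁ × T (accepting (run q w₁))) → T (visits q w)
    from (b ∷ w₁ , w₂ , refl , _ , acc) = visits-prefix q b w₁ w₂ acc

  Profile : Set
  Profile = Fin s → Fin s × Bool

  profile : List B → Profile
  profile w q = run q w , visits q w

  _⊙_ : Profile → Profile → Profile
  (π ⊙ ρ) q = proj₁ (ρ (proj₁ (π q))) , (proj₂ (π q) ∨ proj₂ (ρ (proj₁ (π q))))

  ∏ : {A : Set} → (A → Profile) → List A → Profile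
  ∏ τ [] q = q , false
  ∏ τ (a ∷ w) q = (τ a ⊙ ∏ τ w) q

  profile-++ : ∀ x y → profile (x ++ y) ≗ profile x ⊙ profile y
  profile-++ x y q = cong₂ _,_ (foldl-++ δ q x y) (visits-++ q x y)

  ⊙-cong : {π π′ ρ ρ′ : Profile} → π ≗ π′ → ρ ≗ ρ′ → π ⊙ ρ ≗ π′ ⊙ ρ′
  ⊙-cong {π′ = π′} π≗π′ ρ≗ρ′ q rewrite π≗π′ q | ρ≗ρ′ (proj₁ (π′ q)) = refl

  ∏-cong : {A : Set} {τ τ′ : A → Profile} → (∀ a → τ a ≗ τ′ a) → ∀ w → ∏ τ w ≗ ∏ τ′ w
  ∏-cong τ≗τ′ [] q = refl
  ∏-cong τ≗τ′ (a ∷ w) = ⊙-cong (τ≗τ′ a) (∏-cong τ≗τ′ w)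

  profile-morph : {A : Set} (g : A → List B) (w : List A) → profile (morph g w) ≗ ∏ (profile ∘ g) w
  profile-morph g [] q = refl
  profile-morph g (a ∷ w) q =
    trans (profile-++ (g a) (morph g w) q) (⊙-cong {profile (g a)} (λ _ → refl) (profile-morph g w) q)

  encodeEntry : Fin s × Bool → Fin (s * 2)
  encodeEntry (q , b) = combine q (Inverse.from 2↔Bool b)

  encodeEntry-injective : ∀ x y → encodeEntry x ≡ encodeEntry y → x ≡ y
  encodeEntry-injective (q , b) (q′ , b′) eq =
    let q≡q′ , fb≡fb′ = combine-injective q _ q′ _ eq
    in cong₂ _,_ q≡q′ (trans (sym (Inverse.strictlyInverseˡ 2↔Bool b))
                        (trans (cong (Inverse.to 2↔Bool) fb≡fb′) (Inverse.strictlyInverseˡ 2↔Bool b′)))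

  encode : {n : ℕ} → (Fin n → Profile) → Fin (((s * 2) ^ s) ^ n)
  encode τ = funToFin λ a → funToFin λ q → encodeEntry (τ a q)

  encode-cong : {n : ℕ} {τ τ′ : Fin n → Profile} → (∀ a → τ a ≗ τ′ a) → encode τ ≡ encode τ′
  encode-cong τ≗τ′ = funToFin-cong λ a → funToFin-cong λ q → cong encodeEntry (τ≗τ′ a q)

  encode-injective : {n : ℕ} {τ τ′ : Fin n → Profile} → encode τ ≡ encode τ′ → ∀ a → τ a ≗ τ′ a
  encode-injective eq a q =
    encodeEntry-injective _ _ (funToFin-injective (funToFin-injective eq a) q)

-- The automaton recognising the words ending with u

module SuffixAutomaton {m : ℕ} (u : List (Fin m)) where

  -- A state stores the last |u| letters read, most recent first, padded with fzero.
  window : {k : ℕ} → List (Fin m) → Fin k → Fin (suc m)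
  window [] _ = fzero
  window (b ∷ r) fzero = fsuc b
  window (b ∷ r) (fsuc j) = window r j

  states : ℕ
  states = suc m ^ length u

  State : Set
  State = Fin states

  windowOf : State → Fin (length u) → Fin (suc m)
  windowOf = finToFun

  stateOf : List (Fin m) → State
  stateOf w = funToFin {length u} (window (reverse w))

  push : {k : ℕ} → Fin (suc m) → (Fin k → Fin (suc m)) → Fin k → Fin (suc m)
  push x f fzero = x
  push x f (fsuc j) = f (inject₁ j)

  δ : State → Fin m → State
  δ q b = funToFin (push (fsuc b) (windowOf q))

  agrees? : (q : State) → Dec (∀ j → windowOf q j ≡ window (reverse u) j)
  agrees? q = all? λ j → windowOf q j ≟ᶠ window (reverse u) j

  accepting : State → Bool
  accepting q = isYes (agrees? q)

  open Automaton δ accepting public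

  window-inject₁ : ∀ {k} r (j : Fin k) → window r (inject₁ j) ≡ window r j
  window-inject₁ [] j = refl
  window-inject₁ (b ∷ r) fzero = refl
  window-inject₁ (b ∷ r) (fsuc j) = window-inject₁ r j

  push-window : ∀ {k} b r → push {k} (fsuc b) (finToFun (funToFin {k} (window r))) ≗ window (b ∷ r)
  push-window b r fzero = refl
  push-window b r (fsuc j) = trans (finToFun-funToFin (window r) (inject₁ j)) (window-inject₁ r j)

  δ-stateOf : ∀ w b → δ (stateOf w) b ≡ stateOf (w ++ [ b ])
  δ-stateOf w b = begin
    δ (stateOf w) b                              ≡⟨ funToFin-cong {length u} (push-window b (reverse w)) ⟩
    funToFin {length u} (window (b ∷ reverse w)) ≡⟨ cong (λ r → funToFin {length u} (window r)) (reverse-++ w [ b ]) ⟨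
    stateOf (w ++ [ b ])                         ∎

  run-stateOf : ∀ w x → run (stateOf w) x ≡ stateOf (w ++ x)
  run-stateOf w [] = cong stateOf (sym (++-identityʳ w))
  run-stateOf w (b ∷ x) = begin
    run (δ (stateOf w) b) x        ≡⟨ cong (λ q → run q x) (δ-stateOf w b) ⟩
    run (stateOf (w ++ [ b ])) x   ≡⟨ run-stateOf (w ++ [ b ]) x ⟩
    stateOf ((w ++ [ b ]) ++ x)    ≡⟨ cong stateOf (++-assoc w [ b ] x) ⟩
    stateOf (w ++ b ∷ x)           ∎

  window-agree⇒prefix : ∀ {k} (p r : List (Fin m)) → length p ≡ k →
                        (∀ (j : Fin k) → window r j ≡ window p j) → ∃ λ r′ → r ≡ p ++ r′
  window-agree⇒prefix [] r refl _ = r , refl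
  window-agree⇒prefix (c ∷ p) [] refl agree with () ← agree fzero
  window-agree⇒prefix (c ∷ p) (b ∷ r) refl agree with refl ← agree fzero =
    let r′ , r≡pr′ = window-agree⇒prefix p r refl (agree ∘ fsuc) in r′ , cong (c ∷_) r≡pr′

  prefix⇒window-agree : ∀ {k} (p r′ : List (Fin m)) → length p ≡ k →
                        (j : Fin k) → window (p ++ r′) j ≡ window p j
  prefix⇒window-agree [] r′ refl ()
  prefix⇒window-agree (c ∷ p) r′ refl fzero = refl
  prefix⇒window-agree (c ∷ p) r′ refl (fsuc j) = prefix⇒window-agree p r′ refl j

  accepting⇔suffix : ∀ w → T (accepting (stateOf w)) ⇔ ∃ λ y → w ≡ y ++ u
  accepting⇔suffix w = mk⇔ to from
    where
    to : T (accepting (stateOf w)) → ∃ λ y → w ≡ y ++ u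
    to acc =
      let r′ , rw≡ru++r′ = window-agree⇒prefix (reverse u) (reverse w) (length-reverse u)
                             λ j → trans (sym (finToFun-funToFin _ j)) (toWitness {a? = agrees? (stateOf w)} acc j)
      in reverse r′ , (begin
        w                                 ≡⟨ reverse-involutive w ⟨
        reverse (reverse w)               ≡⟨ cong reverse rw≡ru++r′ ⟩
        reverse (reverse u ++ r′)         ≡⟨ reverse-++ (reverse u) r′ ⟩
        reverse r′ ++ reverse (reverse u) ≡⟨ cong (reverse r′ ++_) (reverse-involutive u) ⟩
        reverse r′ ++ u                   ∎)
    from : (∃ λ y → w ≡ y ++ u) → T (accepting (stateOf w))
    from (y , refl) = fromWitness {a? = agrees? (stateOf (y ++ u))} λ j →
      trans (finToFun-funToFin _ j)
        (trans (cong (λ r → window r j) (reverse-++ y u))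
          (prefix⇒window-agree (reverse u) (reverse y) (length-reverse u) j))

  visits⇔endsInside : ∀ s w → T (visits (stateOf s) w) ⇔ EndsInside u s w
  visits⇔endsInside s w = mk⇔ to from
    where
    to : T (visits (stateOf s) w) → EndsInside u s w
    to visit =
      let w₁ , w₂ , w≡w₁w₂ , 0<|w₁| , acc = Equivalence.to (visits⇔ (stateOf s) w) visit
          acc′ = subst (T ∘ accepting) (run-stateOf s w₁) acc
      in w₁ , w₂ , w≡w₁w₂ , 0<|w₁| , Equivalence.to (accepting⇔suffix (s ++ w₁)) acc′
    from : EndsInside u s w → T (visits (stateOf s) w)
    from (w₁ , w₂ , w≡w₁w₂ , 0<|w₁| , suffix) =
      let acc = Equivalence.from (accepting⇔suffix (s ++ w₁)) suffix
      in Equivalence.from (visits⇔ (stateOf s) w)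
           (w₁ , w₂ , w≡w₁w₂ , 0<|w₁| , subst (T ∘ accepting) (sym (run-stateOf s w₁)) acc)

-- Occurrences of a nonempty word in h(φ^∞(a1))

module Decision {n m : ℕ} (φ : Fin n → List (Fin n)) (a1 : Fin n) (v : List (Fin n))
                (φa1≡a1v : φ a1 ≡ a1 ∷ v) (h : Fin n → List (Fin m)) (c : Fin m) (u : List (Fin m)) where

  open SuffixAutomaton (c ∷ u)

  X Y : ℕ → List (Fin m)
  X k = image φ h k a1
  Y k = morph (image φ h k) v

  X-suc : ∀ k → X (suc k) ≡ X k ++ Y k
  X-suc k = cong (morph (image φ h k)) φa1≡a1v

  open PrefixChain X Y X-suc

  prefix≡X : ∀ k → morph h (iter φ k [ a1 ]) ≡ X k
  prefix≡X k = trans (morph-iter φ h k [ a1 ]) (++-identityʳ (X k))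

  occursAt⇔ : ∀ p → OccursAt φ a1 h (c ∷ u) p ⇔ ∃ λ k → OccursAtList (c ∷ u) p (X k)
  occursAt⇔ p = mk⇔ (λ (k , occ) → k , subst (OccursAtList (c ∷ u) p) (prefix≡X k) occ)
                    (λ (k , occ) → k , subst (OccursAtList (c ∷ u) p) (sym (prefix≡X k)) occ)

  profiles : ℕ → Fin n → Profile
  profiles k a = profile (image φ h k a)

  code : ℕ → Fin (((states * 2) ^ states) ^ n)
  code k = encode (profiles k)

  profiles-code : ∀ k k′ → code k ≡ code k′ → ∀ a → profiles k a ≗ profiles k′ a
  profiles-code k k′ = encode-injective {τ = profiles k} {profiles k′}

  code-det : ∀ k k′ → code k ≡ code k′ → code (suc k) ≡ code (suc k′)
  code-det k k′ eq = encode-cong λ a q → begin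
    profiles (suc k) a q          ≡⟨ profile-morph (image φ h k) (φ a) q ⟩
    ∏ (profiles k) (φ a) q        ≡⟨ ∏-cong (profiles-code k k′ eq) (φ a) q ⟩
    ∏ (profiles k′) (φ a) q       ≡⟨ profile-morph (image φ h k′) (φ a) q ⟨
    profiles (suc k′) a q         ∎

  seenIn freshIn : (Fin n → Profile) → Bool
  seenIn τ = proj₂ (τ a1 (stateOf []))
  freshIn τ = proj₂ (∏ τ v (proj₁ (τ a1 (stateOf []))))

  seenIn-code : ∀ k k′ → code k ≡ code k′ → seenIn (profiles k) ≡ seenIn (profiles k′)
  seenIn-code k k′ eq = cong proj₂ (profiles-code k k′ eq a1 (stateOf []))

  freshIn-code : ∀ k k′ → code k ≡ code k′ → freshIn (profiles k) ≡ freshIn (profiles k′)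
  freshIn-code k k′ eq =
    cong proj₂ (trans (∏-cong (profiles-code k k′ eq) v _)
                      (cong (∏ (profiles k′) v ∘ proj₁) (profiles-code k k′ eq a1 (stateOf []))))

  seenIn⇔ : ∀ k → T (seenIn (profiles k)) ⇔ ∃ λ p → OccursAtList (c ∷ u) p (X k)
  seenIn⇔ k = mk⇔
    (Equivalence.from (occurs⇔endsInside c u (X k)) ∘ Equivalence.to (visits⇔endsInside [] (X k)))
    (Equivalence.from (visits⇔endsInside [] (X k)) ∘ Equivalence.to (occurs⇔endsInside c u (X k)))

  freshIn⇔ : ∀ k → T (freshIn (profiles k)) ⇔ EndsInside (c ∷ u) (X k) (Y k)
  freshIn⇔ k = subst (λ b → T b ⇔ EndsInside (c ∷ u) (X k) (Y k)) freshIn≡visits (visits⇔endsInside (X k) (Y k))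
    where
    freshIn≡visits : visits (stateOf (X k)) (Y k) ≡ freshIn (profiles k)
    freshIn≡visits = begin
      visits (stateOf (X k)) (Y k)                 ≡⟨ cong (λ q → visits q (Y k)) (run-stateOf [] (X k)) ⟨
      visits (run (stateOf []) (X k)) (Y k)        ≡⟨ cong proj₂ (profile-morph (image φ h k) v _) ⟩
      freshIn (profiles k)                         ∎

  module _ {i j : ℕ} (i<j : i < j) (codeᵢ≡codeⱼ : code i ≡ code j) where

    open Repetition code (λ {k} {k′} → code-det k k′) i<j codeᵢ≡codeⱼ

    occurs⇔ : Occurs φ a1 h (c ∷ u) ⇔ ∃ λ k → k < j × T (seenIn (profiles k))
    occurs⇔ = mk⇔ to from
      where
      to : Occurs φ a1 h (c ∷ u) → ∃ λ k → k < j × T (seenIn (profiles k))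
      to (p , occ) =
        let k , occ′ = Equivalence.to (occursAt⇔ p) occ
            k′ , k′<j , eq = representative k
        in k′ , k′<j , subst T (seenIn-code k k′ eq) (Equivalence.from (seenIn⇔ k) (p , occ′))
      from : (∃ λ k → k < j × T (seenIn (profiles k))) → Occurs φ a1 h (c ∷ u)
      from (k , _ , seen) =
        let p , occ = Equivalence.to (seenIn⇔ k) seen in p , Equivalence.from (occursAt⇔ p) (k , occ)

    FreshInWindow : Set
    FreshInWindow = ∃ λ k → k < j × (i ≤ k × T (freshIn (profiles k)))

    finitelyOften⇔ : OccursFinitelyOften φ a1 h (c ∷ u) ⇔ (¬ FreshInWindow)
    finitelyOften⇔ = mk⇔ to from
      where
      to : OccursFinitelyOften φ a1 h (c ∷ u) → ¬ FreshInWindow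
      to (N , bound) (k , _ , i≤k , fresh) =
        let recurs t = let k′ , t≤k′ , _ , eq = recurrent i≤k t
                       in k′ , t≤k′ , Equivalence.to (freshIn⇔ k′) (subst T (freshIn-code k k′ eq) fresh)
            k′ , p , N≤p , occ = occurrences-unbounded (c ∷ u) recurs N
        in <⇒≱ (bound p (Equivalence.from (occursAt⇔ p) (k′ , occ))) N≤p
      from : ¬ FreshInWindow → OccursFinitelyOften φ a1 h (c ∷ u)
      from ¬fresh = length (X i) , λ p occ → decidable-stable (p <? length (X i)) λ p≮Xᵢ →
        let k , occ′ = Equivalence.to (occursAt⇔ p) occ
            k′ , i≤k′ , ends = occursAt⇒endsInside c u i {k} occ′ (≮⇒≥ p≮Xᵢ)
            k″ , i≤k″ , k″<j , eq = window-representative i≤k′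
        in ¬fresh (k″ , k″<j , i≤k″ , subst T (freshIn-code k′ k″ eq) (Equivalence.from (freshIn⇔ k′) ends))

    decide : Dec (Occurs φ a1 h (c ∷ u)) × Dec (OccursFinitelyOften φ a1 h (c ∷ u))
    decide =
      map′ (Equivalence.from occurs⇔) (Equivalence.to occurs⇔) (anyUpTo? (λ k → T? (seenIn (profiles k))) j) ,
      map′ (Equivalence.from finitelyOften⇔) (Equivalence.to finitelyOften⇔)
        (¬? (anyUpTo? (λ k → (i ≤? k) ×-dec T? (freshIn (profiles k))) j))

theorem3 : (n m : ℕ) (φ : Fin n → List (Fin n)) (a1 : Fin n) → Extends φ a1 →
           (h : Fin n → List (Fin m)) (u : List (Fin m)) →
           Dec (Occurs φ a1 h u) × Dec (OccursFinitelyOften φ a1 h u)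
theorem3 n m φ a1 ext h [] = yes (0 , 0 , refl) , no λ (N , bound) → <-irrefl refl (bound N (0 , refl))
theorem3 n m φ a1 (v , φa1≡a1v , _) h (c ∷ u) =
  let i , j , i<j , codeᵢ≡codeⱼ = sequence-repeats code in decide i<j codeᵢ≡codeⱼ
  where open Decision φ a1 v φa1≡a1v h c u
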